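{- Let $G$ be a finite abelian group, $S=\{s,-s,s',-s',s_0\}\subseteq G\setminus\{0\}$ a generating set of $G$ with $|S|=5$, $o(s_0)=2$ and $o(s),o(s')>2$, and $\Gamma=\mathrm{Cay}(G,S)$. For integers $i,j,k$ let $x(i,j,k)=is+js'+ks_0$. Let $a\in\{ -1,1\}$ and let $h,l$ be integers with $0\le h\le o(s)$, $0\le l\le o(s')$ and $x(0,0,0)=x(h,l,0)$. Let $D$ be a perfect code of $\Gamma$ such that $x(i+a,j+1,k+1)\in D$ for all $x(i,j,k)\in D$. Then: (i) if $o(s)$ is even and $s_0=(o(s)/2)s$, then either $\sigma(l)=0$ and $\sigma(o(s))=\sigma(l-ah)+1$, or $\sigma(h)\sigma(l)\neq0$ and $\sigma(o(s))\le\sigma(l-ah)$; (ii) if $o(s')$ is even and $s_0=(o(s')/2)s'$, then either $\sigma(h)=0$ and $\sigma(o(s'))=\sigma(l-ah)+1$, or $\sigma(h)\sigma(l)\neq0$ and $\sigma(o(s'))\le\sigma(l-ah)$.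
   Context: $\mathrm{Cay}(G,S)$ has vertex set $G$ with $x\sim y$ iff $y-x\in S$. A perfect code is a vertex set $C$ such that every vertex is at distance at most $1$ from exactly one vertex of $C$. $o(x)$ is the order of $x$. For an integer $n$, $\sigma(n)$ is the largest nonnegative integer $i$ with $2^i\mid n$ ($\sigma(0)=+\infty$). -}

module Defs where

open import Level using (Level; _⊔_) renaming (suc to lsuc)
open import Algebra.Bundles using (AbelianGroup)
open import Data.Nat as ℕ using (ℕ; zero; suc; _≡ᵇ_)
open import Data.Nat.DivMod using (_/_; _%_)
open import Data.Integer as ℤ using (ℤ; +_; -[1+_])
open import Data.Fin using (Fin)
open import Data.Bool using (if_then_else_)
open import Data.List using (List; []; _∷_; foldr; zipWith; length)
open import Data.List.Relation.Unary.Any using (Any)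
open import Data.List.Relation.Unary.AllPairs using (AllPairs)
open import Data.List.Relation.Unary.All using (All)
open import Data.Product using (Σ; ∃; _×_; _,_)
open import Data.Sum using (_⊎_)
open import Relation.Nullary using (¬_)
open import Relation.Binary.PropositionalEquality using (_≡_)

data ℕ∞ : Set where
  fin : ℕ → ℕ∞
  ∞   : ℕ∞

suc∞ : ℕ∞ → ℕ∞
suc∞ (fin n) = fin (suc n)
suc∞ ∞       = ∞

-- product on ℕ∞, with the convention 0 · ∞ = ∞ · 0 = 0
_*∞_ : ℕ∞ → ℕ∞ → ℕ∞
fin m   *∞ fin n   = fin (m ℕ.* n)
fin zero *∞ ∞      = fin zero
fin (suc _) *∞ ∞   = ∞
∞ *∞ fin zero      = fin zero
∞ *∞ fin (suc _)   = ∞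
∞ *∞ ∞             = ∞

data _≤∞_ : ℕ∞ → ℕ∞ → Set where
  fin≤fin : ∀ {m n} → m ℕ.≤ n → fin m ≤∞ fin n
  _≤∞∞    : ∀ x → x ≤∞ ∞

-- 2-adic valuation.
-- ν f m : number of times 2 divides m (computed with fuel f; with f = m ≥ 1
-- the fuel is always sufficient).
ν : ℕ → ℕ → ℕ
ν zero    _ = 0
ν (suc f) m = if (m % 2 ≡ᵇ 0) then suc (ν f (m / 2)) else 0

σ : ℤ → ℕ∞
σ (+ zero)  = ∞
σ (+ suc n) = fin (ν (suc n) (suc n))
σ -[1+ n ]  = fin (ν (suc n) (suc n))

module GroupDefs {c ℓ : Level} (G : AbelianGroup c ℓ) where
  open AbelianGroup G

  _-ᴳ_ : Carrier → Carrier → Carrier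
  x -ᴳ y = x ∙ (y ⁻¹)

  _×ℕ_ : ℕ → Carrier → Carrier
  zero  ×ℕ x = ε
  suc n ×ℕ x = x ∙ (n ×ℕ x)

  _·_ : ℤ → Carrier → Carrier
  (+ n)      · x = n ×ℕ x
  -[1+ n ]   · x = (suc n ×ℕ x) ⁻¹

  Finite : Set (c ⊔ ℓ)
  Finite = Σ ℕ λ n → Σ (Fin n → Carrier) λ f → ∀ g → ∃ λ i → f i ≈ g

  IsOrder : Carrier → ℕ → Set ℓ
  IsOrder x n = (0 ℕ.< n) × (n ×ℕ x ≈ ε)
                × (∀ m → 0 ℕ.< m → m ×ℕ x ≈ ε → n ℕ.≤ m)

  _∈ₗ_ : Carrier → List Carrier → Set (c ⊔ ℓ)
  x ∈ₗ S = Any (λ y → x ≈ y) S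

  -- the list S has |S| = length S elements (pairwise distinct)
  Distinct : List Carrier → Set (c ⊔ ℓ)
  Distinct = AllPairs (λ x y → ¬ (x ≈ y))

  Nonzero : List Carrier → Set (c ⊔ ℓ)
  Nonzero = All (λ x → ¬ (x ≈ ε))

  lincomb : List ℤ → List Carrier → Carrier
  lincomb ks S = foldr _∙_ ε (zipWith _·_ ks S)

  -- S generates G: the subgroup generated by S (in an abelian group, the
  -- set of integer combinations of elements of S) is all of G.
  Generates : List Carrier → Set (c ⊔ ℓ)
  Generates S = ∀ g → Σ (List ℤ) λ ks → (length ks ≡ length S) × (g ≈ lincomb ks S)

  Adj : List Carrier → Carrier → Carrier → Set (c ⊔ ℓ)
  Adj S x y = (y -ᴳ x) ∈ₗ S

  Dist≤1 : List Carrier → Carrier → Carrier → Set (c ⊔ ℓ)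
  Dist≤1 S x y = (x ≈ y) ⊎ Adj S x y

  IsPerfectCode : ∀ {d} → List Carrier → (Carrier → Set d) → Set (c ⊔ ℓ ⊔ d)
  IsPerfectCode S C =
    (∀ {x y} → x ≈ y → C x → C y) ×
    (∀ v → Σ Carrier λ c → C c × Dist≤1 S c v ×
             (∀ c′ → C c′ → Dist≤1 S c′ v → c′ ≈ c))

-- Proof idea for (i); (ii) is symmetric. Put m = o(s)/2, so s₀ = m s. The translation by t = x(a,1,1) maps
-- D into itself, so a codeword c yields codewords c + N t for all N ≥ 0; if N t = s₀ for some N, the adjacent
-- vertices c and c + s₀ would both be codewords, which a perfect code forbids. Using only the relations
-- h s + l s′ = 0, s₀ = m s and 2 s₀ = 0, the choice N = v l gives N t = s₀ as soon as v e = m w with w odd,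
-- where e = a l − h + l m, because then (N a, N, N − 1) = v (h, l, 0) + (N − 1 − 2r) (−m, 0, 1) + r (0, 0, 2)
-- for w = 1 + 2r. Such a v ≥ 0 exists unless 2^σ(o(s)) divides e. In that case comparing 2-adic valuations in
-- e = a (l − a h) + l m gives σ(l − a h) = σ(m) if l is odd, and σ(l − a h) ≥ σ(o(s)) with h, l even otherwise.

module Submission where

open import Defs
open import Level using (Level)
open import Algebra.Bundles using (AbelianGroup)
open import Data.Nat as ℕ using (ℕ; zero; suc; _<_)
import Data.Nat.Properties as ℕₚ
open import Data.Nat.DivMod using (_/_; _%_; m≡m%n+[m/n]*n; m%n<n; m/n<m; m/n*n≡m)
open import Data.Nat.Divisibility using (_∣_)
open import Data.Integer as ℤ using (ℤ; +_; -[1+_]; -_; _+_; _-_; _*_; _^_; _⊖_)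
import Data.Integer.Properties as ℤₚ
open import Data.Integer.Tactic.RingSolver using (solve-∀)
open import Data.List using (List; []; _∷_)
open import Data.List.Relation.Unary.Any as Any using (here; there)
open import Data.List.Relation.Unary.All using (_∷_)
open import Data.Product using (∃; ∃₂; _×_; _,_; proj₁; proj₂)
open import Data.Sum as Sum using (_⊎_; inj₁; inj₂)
open import Data.Empty using (⊥-elim)
open import Relation.Nullary using (¬_; yes; no)
open import Relation.Binary.PropositionalEquality as ≡ using (_≡_; _≢_)

module IntegerMultiples {c ℓ : Level} (G : AbelianGroup c ℓ) where
  open AbelianGroup G
  open GroupDefs G
  open import Algebra.Properties.AbelianGroup G
  open import Algebra.Properties.CommutativeMonoid.Mult commutativeMonoid
    using (×-homo-+; ×-distrib-+) renaming (_×_ to _×ᴹ_)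
  open import Relation.Binary.Reasoning.Setoid setoid

  ×ℕ≡×ᴹ : ∀ n g → n ×ℕ g ≡ n ×ᴹ g
  ×ℕ≡×ᴹ zero    g = ≡.refl
  ×ℕ≡×ᴹ (suc n) g = ≡.cong (g ∙_) (×ℕ≡×ᴹ n g)

  ×ℕ-homo-+ : ∀ m n g → (m ℕ.+ n) ×ℕ g ≈ m ×ℕ g ∙ n ×ℕ g
  ×ℕ-homo-+ m n g = begin
    (m ℕ.+ n) ×ℕ g      ≡⟨ ×ℕ≡×ᴹ (m ℕ.+ n) g ⟩
    (m ℕ.+ n) ×ᴹ g      ≈⟨ ×-homo-+ g m n ⟩
    m ×ᴹ g ∙ n ×ᴹ g     ≡⟨ ≡.cong₂ _∙_ (×ℕ≡×ᴹ m g) (×ℕ≡×ᴹ n g) ⟨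
    m ×ℕ g ∙ n ×ℕ g     ∎

  ×ℕ-distrib-∙ : ∀ n g h → n ×ℕ (g ∙ h) ≈ n ×ℕ g ∙ n ×ℕ h
  ×ℕ-distrib-∙ n g h = begin
    n ×ℕ (g ∙ h)        ≡⟨ ×ℕ≡×ᴹ n (g ∙ h) ⟩
    n ×ᴹ (g ∙ h)        ≈⟨ ×-distrib-+ g h n ⟩
    n ×ᴹ g ∙ n ×ᴹ h     ≡⟨ ≡.cong₂ _∙_ (×ℕ≡×ᴹ n g) (×ℕ≡×ᴹ n h) ⟨
    n ×ℕ g ∙ n ×ℕ h     ∎

  ×ℕ-congʳ : ∀ n {g h} → g ≈ h → n ×ℕ g ≈ n ×ℕ h
  ×ℕ-congʳ zero    _   = refl
  ×ℕ-congʳ (suc n) g≈h = ∙-cong g≈h (×ℕ-congʳ n g≈h)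

  ·-congʳ : ∀ i {g h} → g ≈ h → i · g ≈ i · h
  ·-congʳ (+ n)    g≈h = ×ℕ-congʳ n g≈h
  ·-congʳ -[1+ n ] g≈h = ⁻¹-cong (×ℕ-congʳ (suc n) g≈h)

  ·-neg : ∀ i g → (- i) · g ≈ (i · g) ⁻¹
  ·-neg (+ zero)  g = sym ε⁻¹≈ε
  ·-neg (+ suc n) g = refl
  ·-neg -[1+ n ]  g = sym (⁻¹-involutive _)

  ⊖-· : ∀ m n g → (m ⊖ n) · g ≈ m ×ℕ g ∙ (n ×ℕ g) ⁻¹
  ⊖-· m       zero    g = sym (trans (∙-congˡ ε⁻¹≈ε) (identityʳ _))
  ⊖-· zero    (suc n) g = sym (identityˡ _)
  ⊖-· (suc m) (suc n) g = begin
    (suc m ⊖ suc n) · g                     ≡⟨ ≡.cong (_· g) (ℤₚ.[1+m]⊖[1+n]≡m⊖n m n) ⟩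
    (m ⊖ n) · g                             ≈⟨ ⊖-· m n g ⟩
    m ×ℕ g ∙ (n ×ℕ g) ⁻¹                    ≈⟨ xyx⁻¹≈y g _ ⟨
    g ∙ (m ×ℕ g ∙ (n ×ℕ g) ⁻¹) ∙ g ⁻¹       ≈⟨ ∙-congʳ (assoc g _ _) ⟨
    (g ∙ m ×ℕ g) ∙ (n ×ℕ g) ⁻¹ ∙ g ⁻¹       ≈⟨ assoc _ _ _ ⟩
    (g ∙ m ×ℕ g) ∙ ((n ×ℕ g) ⁻¹ ∙ g ⁻¹)     ≈⟨ ∙-congˡ (⁻¹-∙-comm _ _) ⟩
    (g ∙ m ×ℕ g) ∙ (n ×ℕ g ∙ g) ⁻¹          ≈⟨ ∙-congˡ (⁻¹-cong (comm _ _)) ⟩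
    suc m ×ℕ g ∙ (suc n ×ℕ g) ⁻¹            ∎

  ·-homo-+ : ∀ i j g → (i + j) · g ≈ i · g ∙ j · g
  ·-homo-+ (+ m)    (+ n)    g = ×ℕ-homo-+ m n g
  ·-homo-+ (+ m)    -[1+ n ] g = ⊖-· m (suc n) g
  ·-homo-+ -[1+ m ] (+ n)    g = trans (⊖-· n (suc m) g) (comm _ _)
  ·-homo-+ -[1+ m ] -[1+ n ] g = begin
    (suc (suc (m ℕ.+ n)) ×ℕ g) ⁻¹            ≡⟨ ≡.cong (λ k → (suc k ×ℕ g) ⁻¹) (ℕₚ.+-suc m n) ⟨
    ((suc m ℕ.+ suc n) ×ℕ g) ⁻¹              ≈⟨ ⁻¹-cong (×ℕ-homo-+ (suc m) (suc n) g) ⟩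
    (suc m ×ℕ g ∙ suc n ×ℕ g) ⁻¹             ≈⟨ ⁻¹-∙-comm _ _ ⟨
    (suc m ×ℕ g) ⁻¹ ∙ (suc n ×ℕ g) ⁻¹        ∎
    where import Data.Nat.Properties as ℕₚ

  +·-assoc : ∀ n j g → (+ n * j) · g ≈ n ×ℕ (j · g)
  +·-assoc zero    j g = refl
  +·-assoc (suc n) j g = begin
    (+ suc n * j) · g        ≡⟨ ≡.cong (_· g) (suc-* (+ n) j) ⟩
    (j + + n * j) · g        ≈⟨ ·-homo-+ j (+ n * j) g ⟩
    j · g ∙ (+ n * j) · g    ≈⟨ ∙-congˡ (+·-assoc n j g) ⟩
    suc n ×ℕ (j · g)         ∎
    where
    suc-* : ∀ n j → (+ 1 + n) * j ≡ j + n * j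
    suc-* = solve-∀

  ·-assoc : ∀ i j g → (i * j) · g ≈ i · (j · g)
  ·-assoc (+ n)    j g = +·-assoc n j g
  ·-assoc -[1+ n ] j g = begin
    (-[1+ n ] * j) · g       ≡⟨ ≡.cong (_· g) (ℤₚ.neg-distribˡ-* (+ suc n) j) ⟨
    (- (+ suc n * j)) · g    ≈⟨ ·-neg (+ suc n * j) g ⟩
    ((+ suc n * j) · g) ⁻¹   ≈⟨ ⁻¹-cong (+·-assoc (suc n) j g) ⟩
    -[1+ n ] · (j · g)       ∎

  ·-distrib-∙ : ∀ i g h → i · (g ∙ h) ≈ i · g ∙ i · h
  ·-distrib-∙ (+ n)    g h = ×ℕ-distrib-∙ n g h
  ·-distrib-∙ -[1+ n ] g h = trans (⁻¹-cong (×ℕ-distrib-∙ (suc n) g h)) (sym (⁻¹-∙-comm _ _))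

  ·-ε : ∀ i → i · ε ≈ ε
  ·-ε i = begin
    i · ε              ≡⟨⟩
    i · ((+ 0) · ε)    ≈⟨ ·-assoc i (+ 0) ε ⟨
    (i * + 0) · ε      ≡⟨ ≡.cong (_· ε) (ℤₚ.*-zeroʳ i) ⟩
    ε                  ∎

module PerfectCode {c ℓ : Level} (G : AbelianGroup c ℓ) where
  open AbelianGroup G
  open GroupDefs G
  open import Algebra.Properties.AbelianGroup G

  adjacent-codewords⇒≈ε : ∀ {d S} {D : Carrier → Set d} → IsPerfectCode S D →
                          ∀ {g c} → g ∈ₗ S → D c → D (c ∙ g) → g ≈ ε
  adjacent-codewords⇒≈ε {S = S} (_ , cover) {g} {c} g∈S Dc Dcg with cover (c ∙ g)
  ... | _ , _ , _ , unique =
    identityʳ-unique c g (trans (unique (c ∙ g) Dcg (inj₁ refl)) (sym (unique c Dc (inj₂ c∼cg))))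
    where
    c∼cg : ((c ∙ g) -ᴳ c) ∈ₗ S
    c∼cg = Any.map (trans (xyx⁻¹≈y c g)) g∈S

module Coordinates {c ℓ : Level} (G : AbelianGroup c ℓ) (s s′ s₀ : AbelianGroup.Carrier G) where
  open AbelianGroup G hiding (_-_)
  open GroupDefs G
  open IntegerMultiples G
  open import Algebra.Properties.AbelianGroup G
  open import Algebra.Properties.CommutativeSemigroup commutativeSemigroup using (interchange)
  open import Relation.Binary.Reasoning.Setoid setoid

  S : List Carrier
  S = s ∷ (s ⁻¹) ∷ s′ ∷ (s′ ⁻¹) ∷ s₀ ∷ []

  x : ℤ → ℤ → ℤ → Carrier
  x i j k = ((i · s) ∙ (j · s′)) ∙ (k · s₀)

  x-≡ : ∀ {i i′ j j′ k k′} → i ≡ i′ → j ≡ j′ → k ≡ k′ → x i j k ≡ x i′ j′ k′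
  x-≡ ≡.refl ≡.refl ≡.refl = ≡.refl

  x-homo : ∀ i j k i′ j′ k′ → x (i + i′) (j + j′) (k + k′) ≈ x i j k ∙ x i′ j′ k′
  x-homo i j k i′ j′ k′ = begin
    x (i + i′) (j + j′) (k + k′)                         ≈⟨ ∙-cong (∙-cong (·-homo-+ i i′ s) (·-homo-+ j j′ s′)) (·-homo-+ k k′ s₀) ⟩
    ((i · s ∙ i′ · s) ∙ (j · s′ ∙ j′ · s′)) ∙ (k · s₀ ∙ k′ · s₀)
                                                         ≈⟨ ∙-congʳ (interchange _ _ _ _) ⟩
    ((i · s ∙ j · s′) ∙ (i′ · s ∙ j′ · s′)) ∙ (k · s₀ ∙ k′ · s₀)
                                                         ≈⟨ interchange _ _ _ _ ⟩
    x i j k ∙ x i′ j′ k′                                 ∎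

  x-scale : ∀ n i j k → x (n * i) (n * j) (n * k) ≈ n · x i j k
  x-scale n i j k = begin
    x (n * i) (n * j) (n * k)                   ≈⟨ ∙-cong (∙-cong (·-assoc n i s) (·-assoc n j s′)) (·-assoc n k s₀) ⟩
    (n · (i · s) ∙ n · (j · s′)) ∙ n · (k · s₀)  ≈⟨ ∙-congʳ (·-distrib-∙ n _ _) ⟨
    n · (i · s ∙ j · s′) ∙ n · (k · s₀)          ≈⟨ ·-distrib-∙ n _ _ ⟨
    n · x i j k                                  ∎

  -- (i, j, k) is a relation among s, s′, s₀; a record rather than x i j k ≈ ε so that i, j, k are inferable
  record Null (i j k : ℤ) : Set ℓ where
    constructor null
    field x≈ε : x i j k ≈ ε

  null-≡ : ∀ {i i′ j j′ k k′} → i ≡ i′ → j ≡ j′ → k ≡ k′ → Null i j k → Null i′ j′ k′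
  null-≡ ≡.refl ≡.refl ≡.refl v = v

  null-+ : ∀ {i j k i′ j′ k′} → Null i j k → Null i′ j′ k′ → Null (i + i′) (j + j′) (k + k′)
  null-+ {i} {j} {k} {i′} {j′} {k′} (null x≈ε) (null x′≈ε) = null (begin
    x (i + i′) (j + j′) (k + k′)  ≈⟨ x-homo i j k i′ j′ k′ ⟩
    x i j k ∙ x i′ j′ k′          ≈⟨ ∙-cong x≈ε x′≈ε ⟩
    ε ∙ ε                         ≈⟨ identityˡ ε ⟩
    ε                             ∎)

  null-* : ∀ n {i j k} → Null i j k → Null (n * i) (n * j) (n * k)
  null-* n {i} {j} {k} (null x≈ε) = null (begin
    x (n * i) (n * j) (n * k)  ≈⟨ x-scale n i j k ⟩
    n · x i j k                ≈⟨ ·-congʳ n x≈ε ⟩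
    n · ε                      ≈⟨ ·-ε n ⟩
    ε                          ∎)

  x≈x-mod-null : ∀ {i j k i′ j′ k′} → Null (i - i′) (j - j′) (k - k′) → x i j k ≈ x i′ j′ k′
  x≈x-mod-null {i} {j} {k} {i′} {j′} {k′} (null x≈ε) = begin
    x i j k                                            ≡⟨ x-≡ (split i i′) (split j j′) (split k k′) ⟩
    x (i′ + (i - i′)) (j′ + (j - j′)) (k′ + (k - k′))  ≈⟨ x-homo i′ j′ k′ _ _ _ ⟩
    x i′ j′ k′ ∙ x (i - i′) (j - j′) (k - k′)          ≈⟨ ∙-congˡ x≈ε ⟩
    x i′ j′ k′ ∙ ε                                     ≈⟨ identityʳ _ ⟩
    x i′ j′ k′                                         ∎
    where
    split : ∀ i i′ → i ≡ i′ + (i - i′)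
    split = solve-∀

  x-axis₁ : ∀ i → x i (+ 0) (+ 0) ≈ i · s
  x-axis₁ i = trans (identityʳ _) (identityʳ _)

  x-axis₂ : ∀ j → x (+ 0) j (+ 0) ≈ j · s′
  x-axis₂ j = trans (identityʳ _) (identityˡ _)

  x-axis₃ : ∀ k → x (+ 0) (+ 0) k ≈ k · s₀
  x-axis₃ k = trans (∙-congʳ (identityˡ ε)) (identityˡ _)

  S⊆image-x : ∀ {g} → g ∈ₗ S → ∃ λ ((i , j , k) : ℤ × ℤ × ℤ) → g ≈ x i j k
  S⊆image-x (here g≈s)                           = (+ 1 , + 0 , + 0) , trans g≈s (sym (trans (x-axis₁ (+ 1)) (identityʳ s)))
  S⊆image-x (there (here g≈s⁻¹))                 = (- + 1 , + 0 , + 0) , trans g≈s⁻¹ (sym (trans (x-axis₁ (- + 1)) (⁻¹-cong (identityʳ s))))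
  S⊆image-x (there (there (here g≈s′)))          = (+ 0 , + 1 , + 0) , trans g≈s′ (sym (trans (x-axis₂ (+ 1)) (identityʳ s′)))
  S⊆image-x (there (there (there (here g≈s′⁻¹)))) = (+ 0 , - + 1 , + 0) , trans g≈s′⁻¹ (sym (trans (x-axis₂ (- + 1)) (⁻¹-cong (identityʳ s′))))
  S⊆image-x (there (there (there (there (here g≈s₀))))) = (+ 0 , + 0 , + 1) , trans g≈s₀ (sym (trans (x-axis₃ (+ 1)) (identityʳ s₀)))

  x≈s₀-mod-null : ∀ i j k → Null (i - + 0) (j - + 0) (k - + 1) → x i j k ≈ s₀
  x≈s₀-mod-null i j k v = trans (x≈x-mod-null {i} {j} {k} {+ 0} {+ 0} {+ 1} v) (trans (x-axis₃ (+ 1)) (identityʳ s₀))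

  null-s₀≈·s : ∀ {m} → s₀ ≈ m · s → Null (- m) (+ 0) (+ 1)
  null-s₀≈·s {m} s₀≈ = null (begin
    x (- m) (+ 0) (+ 1)   ≈⟨ ∙-cong (identityʳ _) (identityʳ s₀) ⟩
    (- m) · s ∙ s₀        ≈⟨ ∙-cong (·-neg m s) s₀≈ ⟩
    (m · s) ⁻¹ ∙ m · s    ≈⟨ inverseˡ _ ⟩
    ε                     ∎)

  null-s₀≈·s′ : ∀ {m} → s₀ ≈ m · s′ → Null (+ 0) (- m) (+ 1)
  null-s₀≈·s′ {m} s₀≈ = null (begin
    x (+ 0) (- m) (+ 1)   ≈⟨ ∙-cong (identityˡ _) (identityʳ s₀) ⟩
    (- m) · s′ ∙ s₀       ≈⟨ ∙-cong (·-neg m s′) s₀≈ ⟩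
    (m · s′) ⁻¹ ∙ m · s′  ≈⟨ inverseˡ _ ⟩
    ε                     ∎)

  null-order-s₀ : 2 ×ℕ s₀ ≈ ε → Null (+ 0) (+ 0) (+ 2)
  null-order-s₀ 2s₀≈ε = null (trans (x-axis₃ (+ 2)) 2s₀≈ε)

  module Translation {d} {D : Carrier → Set d} (code : IsPerfectCode S D) (a : ℤ)
    (closed : ∀ i j k → D (x i j k) → D (x (i + a) (j + + 1) (k + + 1))) where

    private
      D-resp : ∀ {g h} → g ≈ h → D g → D h
      D-resp = proj₁ code

    -- ε and its neighbours have explicit coordinates, hence so does the codeword dominating ε
    codeword-coordinates : ∃ λ ((i , j , k) : ℤ × ℤ × ℤ) → D (x i j k)
    codeword-coordinates with proj₂ code ε
    ... | c , Dc , inj₁ c≈ε , _ = (+ 0 , + 0 , + 0) , D-resp (trans c≈ε (sym (x-axis₁ (+ 0)))) Dc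
    ... | c , Dc , inj₂ ε-c∈S , _ with S⊆image-x ε-c∈S
    ...   | (i , j , k) , ε-c≈x = (- + 1 * i , - + 1 * j , - + 1 * k) , D-resp c≈x Dc
      where
      c≈x : c ≈ x (- + 1 * i) (- + 1 * j) (- + 1 * k)
      c≈x = begin
        c                 ≈⟨ ⁻¹-involutive c ⟨
        c ⁻¹ ⁻¹           ≈⟨ ⁻¹-cong (identityˡ (c ⁻¹)) ⟨
        (ε -ᴳ c) ⁻¹       ≈⟨ ⁻¹-cong ε-c≈x ⟩
        x i j k ⁻¹        ≈⟨ ⁻¹-cong (identityʳ _) ⟨
        (- + 1) · x i j k ≈⟨ x-scale (- + 1) i j k ⟨
        x (- + 1 * i) (- + 1 * j) (- + 1 * k)  ∎

    iterate : ∀ N {i j k} → D (x i j k) → D (x (i + + N * a) (j + + N) (k + + N))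
    iterate zero    {i} {j} {k} Dx = ≡.subst D (x-≡ (≡.sym (ℤₚ.+-identityʳ i)) (≡.sym (ℤₚ.+-identityʳ j)) (≡.sym (ℤₚ.+-identityʳ k))) Dx
    iterate (suc N) {i} {j} {k} Dx =
      ≡.subst D (x-≡ (step-a i a (+ N)) (step-1 j (+ N)) (step-1 k (+ N))) (iterate N {i + a} {j + + 1} {k + + 1} (closed i j k Dx))
      where
      step-a : ∀ i a n → (i + a) + n * a ≡ i + (+ 1 + n) * a
      step-a = solve-∀
      step-1 : ∀ j n → (j + + 1) + n ≡ j + (+ 1 + n)
      step-1 = solve-∀

    no-shift-onto-s₀ : ¬ s₀ ≈ ε → ∀ N → ¬ x (+ N * a) (+ N) (+ N) ≈ s₀
    no-shift-onto-s₀ s₀≉ε N shift with codeword-coordinates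
    ... | (i , j , k) , Dx = s₀≉ε (adjacent-codewords⇒≈ε code s₀∈S Dx (D-resp shifted≈ (iterate N {i} {j} {k} Dx)))
      where
      open PerfectCode G
      s₀∈S : s₀ ∈ₗ S
      s₀∈S = there (there (there (there (here refl))))
      shifted≈ : x (i + + N * a) (j + + N) (k + + N) ≈ x i j k ∙ s₀
      shifted≈ = trans (x-homo i j k _ _ _) (∙-congˡ shift)

-- 2-adic valuations of integers

open ≡ using (refl; sym; trans; cong; cong₂; subst; subst₂)
open ≡.≡-Reasoning
open import Algebra.Properties.CommutativeSemigroup ℤₚ.*-commutativeSemigroup using (x∙yz≈y∙xz)

Odd : ℤ → Set
Odd w = ∃ λ r → w ≡ + 1 + + 2 * r

Even : ℤ → Set
Even z = ∃ λ y → z ≡ + 2 * y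

by-linear-combination : ∀ {L R X Y : ℤ} → X ≡ Y → ∀ c → L ≡ R + c * (X - Y) → L ≡ R
by-linear-combination {R = R} {X} refl c L≡ = trans L≡ (vanish R c X)
  where
  vanish : ∀ R c X → R + c * (X - X) ≡ R
  vanish = solve-∀

even≢odd : ∀ y r → + 2 * y ≢ + 1 + + 2 * r
even≢odd y r 2y≡1+2r = 2≢1 (ℕₚ.m*n≡1⇒m≡1 2 ℤ.∣ y - r ∣ (begin
  2 ℕ.* ℤ.∣ y - r ∣    ≡⟨ ℤₚ.abs-* (+ 2) (y - r) ⟨
  ℤ.∣ + 2 * (y - r) ∣  ≡⟨ cong ℤ.∣_∣ 2[y-r]≡1 ⟩
  1                    ∎))
  where
  2≢1 : 2 ≢ 1
  2≢1 ()
  identity : ∀ y r → + 2 * (y - r) ≡ + 1 + + 1 * (+ 2 * y - (+ 1 + + 2 * r))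
  identity = solve-∀
  2[y-r]≡1 : + 2 * (y - r) ≡ + 1
  2[y-r]≡1 = by-linear-combination 2y≡1+2r (+ 1) (identity y r)

ν-decomposition : ∀ f m → 0 ℕ.< m → m ℕ.≤ f →
                  ∃ λ q → q % 2 ≡ 1 × m ≡ 2 ℕ.^ ν f m ℕ.* q
ν-decomposition zero m 0<m m≤0 = ⊥-elim (ℕₚ.<⇒≱ 0<m m≤0)
ν-decomposition (suc f) m 0<m m≤1+f with m % 2 in m%2 | m%n<n m 2
-- abstracting m % 2 lets ν (suc f) m compute in the goal
... | 1 | _ = m , m%2 , sym (ℕₚ.*-identityˡ m)
... | suc (suc _) | ℕ.s≤s (ℕ.s≤s ())
... | 0 | _ =
  let q , q-odd , m/2≡ = ν-decomposition f (m / 2) 0<m/2 (ℕₚ.≤-pred (ℕₚ.<-≤-trans m/2<m m≤1+f))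
  in q , q-odd , (begin
    m                                    ≡⟨ m≡2[m/2] ⟩
    2 ℕ.* (m / 2)                        ≡⟨ cong (2 ℕ.*_) m/2≡ ⟩
    2 ℕ.* (2 ℕ.^ ν f (m / 2) ℕ.* q)      ≡⟨ ℕₚ.*-assoc 2 (2 ℕ.^ ν f (m / 2)) q ⟨
    2 ℕ.^ suc (ν f (m / 2)) ℕ.* q        ∎)
  where
  instance _ = ℕ.>-nonZero 0<m
  m≡2[m/2] : m ≡ 2 ℕ.* (m / 2)
  m≡2[m/2] = trans (m≡m%n+[m/n]*n m 2) (trans (cong (ℕ._+ (m / 2 ℕ.* 2)) m%2) (ℕₚ.*-comm (m / 2) 2))
  0<m/2 : 0 ℕ.< m / 2
  0<m/2 = ℕₚ.n≢0⇒n>0 λ m/2≡0 → ℕₚ.<⇒≢ 0<m (sym (trans m≡2[m/2] (cong (2 ℕ.*_) m/2≡0)))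
  m/2<m : m / 2 ℕ.< m
  m/2<m = m/n<m m 2 (ℕ.s≤s (ℕ.s≤s ℕ.z≤n))

pos-2^ : ∀ j → + (2 ℕ.^ j) ≡ (+ 2) ^ j
pos-2^ zero    = refl
pos-2^ (suc j) = trans (ℤₚ.pos-* 2 (2 ℕ.^ j)) (cong (+ 2 *_) (pos-2^ j))

%2≡1⇒odd : ∀ {q} → q % 2 ≡ 1 → Odd (+ q)
%2≡1⇒odd {q} q%2≡1 = + (q / 2) , (begin
  + q                        ≡⟨ cong +_ (m≡m%n+[m/n]*n q 2) ⟩
  + (q % 2 ℕ.+ q / 2 ℕ.* 2)  ≡⟨ cong (λ t → + (t ℕ.+ q / 2 ℕ.* 2)) q%2≡1 ⟩
  + 1 + + (q / 2 ℕ.* 2)      ≡⟨ cong (_+_ (+ 1)) (trans (ℤₚ.pos-* (q / 2) 2) (ℤₚ.*-comm (+ (q / 2)) (+ 2))) ⟩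
  + 1 + + 2 * + (q / 2)      ∎)

odd-neg : ∀ {w} → Odd w → Odd (- w)
odd-neg (r , refl) = - r - + 1 , identity r
  where
  identity : ∀ r → - (+ 1 + + 2 * r) ≡ + 1 + + 2 * (- r - + 1)
  identity = solve-∀

odd≢0 : ∀ {w} → Odd w → w ≢ + 0
odd≢0 (r , w≡) w≡0 = even≢odd (+ 0) r (trans (sym w≡0) w≡)

2^≢0 : ∀ j → (+ 2) ^ j ≢ + 0
2^≢0 j 2^j≡0 with ℤₚ.i^n≡0⇒i≡0 (+ 2) j 2^j≡0
... | ()

2-adic-decomposition : ∀ z → z ≡ + 0 ⊎ ∃₂ λ j w → Odd w × σ z ≡ fin j × z ≡ (+ 2) ^ j * w
2-adic-decomposition (+ zero)  = inj₁ refl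
2-adic-decomposition (+ suc n) =
  let q , q%2≡1 , 1+n≡ = ν-decomposition (suc n) (suc n) (ℕ.s≤s ℕ.z≤n) ℕₚ.≤-refl
      j = ν (suc n) (suc n)
  in inj₂ (j , + q , %2≡1⇒odd q%2≡1 , refl , (begin
    + suc n                ≡⟨ cong +_ 1+n≡ ⟩
    + (2 ℕ.^ j ℕ.* q)      ≡⟨ ℤₚ.pos-* (2 ℕ.^ j) q ⟩
    + (2 ℕ.^ j) * + q      ≡⟨ cong (_* + q) (pos-2^ j) ⟩
    (+ 2) ^ j * + q        ∎))
2-adic-decomposition -[1+ n ] with 2-adic-decomposition (+ suc n)
... | inj₂ (j , w , w-odd , σ≡ , 1+n≡) =
  inj₂ (j , - w , odd-neg w-odd , σ≡ , trans (cong -_ 1+n≡) (ℤₚ.neg-distribʳ-* ((+ 2) ^ j) w))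

2^-exponent-≤ : ∀ i j y w → (+ 2) ^ i * y ≡ (+ 2) ^ j * w → Odd w → i ℕ.≤ j
2^-exponent-≤ i j y w eq (r , w≡) with i ℕ.≤? j
... | yes i≤j = i≤j
... | no  i≰j = ⊥-elim (even≢odd ((+ 2) ^ t * y) r (trans 2[2^t*y]≡w w≡))
  where
  t = i ℕ.∸ suc j
  instance _ = ℤ.≢-nonZero (2^≢0 j)
  2^i≡ : (+ 2) ^ i ≡ (+ 2) ^ j * (+ 2 * (+ 2) ^ t)
  2^i≡ = begin
    (+ 2) ^ i               ≡⟨ cong (_^_ (+ 2)) (ℕₚ.m+[n∸m]≡n (ℕₚ.≰⇒> i≰j)) ⟨
    (+ 2) ^ (suc j ℕ.+ t)   ≡⟨ cong (_^_ (+ 2)) (ℕₚ.+-suc j t) ⟨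
    (+ 2) ^ (j ℕ.+ suc t)   ≡⟨ ℤₚ.^-distribˡ-+-* (+ 2) j (suc t) ⟩
    (+ 2) ^ j * (+ 2 * (+ 2) ^ t)   ∎
  2[2^t*y]≡w : + 2 * ((+ 2) ^ t * y) ≡ w
  2[2^t*y]≡w = ℤₚ.*-cancelˡ-≡ ((+ 2) ^ j) _ w (begin
    (+ 2) ^ j * (+ 2 * ((+ 2) ^ t * y))   ≡⟨ cong ((+ 2) ^ j *_) (ℤₚ.*-assoc (+ 2) ((+ 2) ^ t) y) ⟨
    (+ 2) ^ j * (+ 2 * (+ 2) ^ t * y)     ≡⟨ ℤₚ.*-assoc ((+ 2) ^ j) _ y ⟨
    (+ 2) ^ j * (+ 2 * (+ 2) ^ t) * y     ≡⟨ cong (_* y) 2^i≡ ⟨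
    (+ 2) ^ i * y                         ≡⟨ eq ⟩
    (+ 2) ^ j * w                         ∎)

σ-2^*odd : ∀ j w → Odd w → σ ((+ 2) ^ j * w) ≡ fin j
σ-2^*odd j w w-odd with 2-adic-decomposition ((+ 2) ^ j * w)
... | inj₁ 2^j*w≡0 with ℤₚ.i*j≡0⇒i≡0∨j≡0 ((+ 2) ^ j) 2^j*w≡0
...   | inj₁ 2^j≡0 = ⊥-elim (2^≢0 j 2^j≡0)
...   | inj₂ w≡0   = ⊥-elim (odd≢0 w-odd w≡0)
σ-2^*odd j w w-odd | inj₂ (i , w′ , w′-odd , σ≡ , eq) =
  trans σ≡ (cong fin (ℕₚ.≤-antisym (2^-exponent-≤ i j w′ w (sym eq) w-odd)
                                  (2^-exponent-≤ j i w w′ eq w′-odd)))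

2^≤σ : ∀ i y → fin i ≤∞ σ ((+ 2) ^ i * y)
2^≤σ i y with 2-adic-decomposition ((+ 2) ^ i * y)
... | inj₁ 2^i*y≡0 rewrite 2^i*y≡0 = fin i ≤∞∞
... | inj₂ (j , w , w-odd , σ≡ , eq) rewrite σ≡ = fin≤fin (2^-exponent-≤ i j y w eq w-odd)

odd-or-even : ∀ z → Odd z ⊎ Even z
odd-or-even z with 2-adic-decomposition z
... | inj₁ z≡0 = inj₂ (+ 0 , z≡0)
... | inj₂ (zero  , w , w-odd , _ , z≡) = inj₁ (subst Odd (sym (trans z≡ (ℤₚ.*-identityˡ w))) w-odd)
... | inj₂ (suc j , w , _ , _ , z≡) = inj₂ ((+ 2) ^ j * w , trans z≡ (ℤₚ.*-assoc (+ 2) ((+ 2) ^ j) w))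

odd⇒σ≡0 : ∀ {w} → Odd w → σ w ≡ fin 0
odd⇒σ≡0 {w} w-odd = trans (cong σ (sym (ℤₚ.*-identityˡ w))) (σ-2^*odd 0 w w-odd)

even⇒σ≢0 : ∀ {z} → Even z → σ z ≢ fin 0
even⇒σ≢0 (y , refl) σ≡0 with subst (fin 1 ≤∞_) σ≡0 (2^≤σ 1 y)
... | fin≤fin ()

*∞-≢0 : ∀ {m n} → m ≢ fin 0 → n ≢ fin 0 → m *∞ n ≢ fin 0
*∞-≢0 {fin zero}    m≢0 _   = λ _ → m≢0 refl
*∞-≢0 {fin (suc _)} {fin zero}    _ n≢0 = λ _ → n≢0 refl
*∞-≢0 {fin (suc _)} {fin (suc _)} _ _   ()
*∞-≢0 {fin (suc _)} {∞}           _ _   ()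
*∞-≢0 {∞}           {fin zero}    _ n≢0 = λ _ → n≢0 refl
*∞-≢0 {∞}           {fin (suc _)} _ _   ()
*∞-≢0 {∞}           {∞}           _ _   ()

divisible-or-odd-multiple : ∀ k q e → (∃ λ E → e ≡ (+ 2) ^ suc k * E)
                                    ⊎ (∃₂ λ v w → Odd w × + v * e ≡ (+ 2) ^ k * + q * w)
divisible-or-odd-multiple k q e with 2-adic-decomposition e
... | inj₁ e≡0 = inj₁ (+ 0 , trans e≡0 (sym (ℤₚ.*-zeroʳ ((+ 2) ^ suc k))))
... | inj₂ (j , w , w-odd , _ , e≡) with suc k ℕ.≤? j
...   | yes k<j = inj₁ ((+ 2) ^ t * w , (begin
  e                                  ≡⟨ e≡ ⟩
  (+ 2) ^ j * w                      ≡⟨ cong (λ i → (+ 2) ^ i * w) (ℕₚ.m+[n∸m]≡n k<j) ⟨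
  (+ 2) ^ (suc k ℕ.+ t) * w          ≡⟨ cong (_* w) (ℤₚ.^-distribˡ-+-* (+ 2) (suc k) t) ⟩
  (+ 2) ^ suc k * (+ 2) ^ t * w      ≡⟨ ℤₚ.*-assoc ((+ 2) ^ suc k) _ w ⟩
  (+ 2) ^ suc k * ((+ 2) ^ t * w)    ∎))
  where t = j ℕ.∸ suc k
...   | no k≮j = inj₂ (2 ℕ.^ t ℕ.* q , w , w-odd , (begin
  + (2 ℕ.^ t ℕ.* q) * e                    ≡⟨ cong₂ _*_ (trans (ℤₚ.pos-* (2 ℕ.^ t) q) (cong (_* + q) (pos-2^ t))) e≡ ⟩
  (+ 2) ^ t * + q * ((+ 2) ^ j * w)        ≡⟨ rearrange ((+ 2) ^ t) (+ q) ((+ 2) ^ j) w ⟩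
  (+ 2) ^ j * (+ 2) ^ t * + q * w          ≡⟨ cong (λ P → P * + q * w) (ℤₚ.^-distribˡ-+-* (+ 2) j t) ⟨
  (+ 2) ^ (j ℕ.+ t) * + q * w              ≡⟨ cong (λ i → (+ 2) ^ i * + q * w) (ℕₚ.m+[n∸m]≡n (ℕₚ.≤-pred (ℕₚ.≰⇒> k≮j))) ⟩
  (+ 2) ^ k * + q * w                      ∎))
  where
  t = k ℕ.∸ j
  rearrange : ∀ A q B w → A * q * (B * w) ≡ B * A * q * w
  rearrange = solve-∀

factorise-divisible-sum : ∀ {k d u q E} → Odd q →
  d + u * ((+ 2) ^ k * q) ≡ (+ 2) ^ suc k * E →
  (Odd u × ∃ λ W → Odd W × d ≡ (+ 2) ^ k * W) ⊎ (Even u × ∃ λ Y → d ≡ (+ 2) ^ suc k * Y)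
factorise-divisible-sum {k} {d} {u} {E = E} (t , refl) sum≡ with odd-or-even u
... | inj₁ (r , refl) =
  inj₁ ((r , refl) , + 2 * E - u * q , (E - r - t - + 2 * r * t - + 1 , odd-witness E r t) ,
        by-linear-combination sum≡ (+ 1) (factorisation d r t ((+ 2) ^ k) E))
  where
  q = + 1 + + 2 * t
  odd-witness : ∀ E r t → + 2 * E - (+ 1 + + 2 * r) * (+ 1 + + 2 * t)
                          ≡ + 1 + + 2 * (E - r - t - + 2 * r * t - + 1)
  odd-witness = solve-∀
  factorisation : ∀ d r t P E →
    d ≡ P * (+ 2 * E - (+ 1 + + 2 * r) * (+ 1 + + 2 * t))
        + + 1 * (d + (+ 1 + + 2 * r) * (P * (+ 1 + + 2 * t)) - + 2 * P * E)
  factorisation = solve-∀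
... | inj₂ (y , refl) =
  inj₂ ((y , refl) , E - y * (+ 1 + + 2 * t) ,
        by-linear-combination sum≡ (+ 1) (factorisation d y t ((+ 2) ^ k) E))
  where
  factorisation : ∀ d y t P E →
    d ≡ + 2 * P * (E - y * (+ 1 + + 2 * t))
        + + 1 * (d + + 2 * y * (P * (+ 1 + + 2 * t)) - + 2 * P * E)
  factorisation = solve-∀

half-decomposition : ∀ {n} → 2 ∣ n → 0 ℕ.< n →
                     ∃₂ λ k q → Odd (+ q) × + (n / 2) ≡ (+ 2) ^ k * + q × σ (+ n) ≡ fin (suc k)
half-decomposition {n} 2∣n 0<n =
  let q , q%2≡1 , m≡ = ν-decomposition m m 0<m ℕₚ.≤-refl
      k = ν m m
      +m≡ : + m ≡ (+ 2) ^ k * + q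
      +m≡ = trans (cong +_ m≡) (trans (ℤₚ.pos-* (2 ℕ.^ k) q) (cong (_* + q) (pos-2^ k)))
  in k , q , %2≡1⇒odd q%2≡1 , +m≡ , trans (cong σ (begin
    + n                          ≡⟨ cong +_ (trans (sym (m/n*n≡m 2∣n)) (ℕₚ.*-comm m 2)) ⟩
    + (2 ℕ.* m)                  ≡⟨ ℤₚ.pos-* 2 m ⟩
    + 2 * + m                    ≡⟨ cong (+ 2 *_) +m≡ ⟩
    + 2 * ((+ 2) ^ k * + q)      ≡⟨ ℤₚ.*-assoc (+ 2) ((+ 2) ^ k) (+ q) ⟨
    (+ 2) ^ suc k * + q          ∎)) (σ-2^*odd (suc k) (+ q) (%2≡1⇒odd q%2≡1))
  where
  m = n / 2
  0<m : 0 ℕ.< m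
  0<m = ℕₚ.n≢0⇒n>0 λ m≡0 → ℕₚ.<⇒≢ 0<n (sym (trans (sym (m/n*n≡m 2∣n)) (cong (ℕ._* 2) m≡0)))

IsUnit : ℤ → Set
IsUnit a = a ≡ - + 1 ⊎ a ≡ + 1

unit-squared : ∀ {a} → IsUnit a → a * a ≡ + 1
unit-squared (inj₁ refl) = refl
unit-squared (inj₂ refl) = refl

unit-neg : ∀ {a} → IsUnit a → IsUnit (- a)
unit-neg (inj₁ refl) = inj₂ refl
unit-neg (inj₂ refl) = inj₁ refl

odd-unit-* : ∀ {c w} → IsUnit c → Odd w → Odd (c * w)
odd-unit-* (inj₁ refl) (r , refl) = - r - + 1 , identity r
  where
  identity : ∀ r → - + 1 * (+ 1 + + 2 * r) ≡ + 1 + + 2 * (- r - + 1)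
  identity = solve-∀
odd-unit-* (inj₂ refl) (r , refl) = r , identity r
  where
  identity : ∀ r → + 1 * (+ 1 + + 2 * r) ≡ + 1 + + 2 * r
  identity = solve-∀

even-combination : ∀ {u d} → Even u → Even d → ∀ c₁ c₂ → Even (c₁ * u + c₂ * d)
even-combination (y , refl) (z , refl) c₁ c₂ = c₁ * y + c₂ * z , identity c₁ y c₂ z
  where
  identity : ∀ c₁ y c₂ z → c₁ * (+ 2 * y) + c₂ * (+ 2 * z) ≡ + 2 * (c₁ * y + c₂ * z)
  identity = solve-∀

ValuationAlternatives : ℕ → ℤ → ℤ → ℤ → ℤ → Set
ValuationAlternatives n u h l d =
  ((σ u ≡ fin 0) × (σ (+ n) ≡ suc∞ (σ d))) ⊎ ((σ h *∞ σ l ≢ fin 0) × (σ (+ n) ≤∞ σ d))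

valuation-alternatives : ∀ {n k u h l c d δ} → IsUnit c → σ (+ n) ≡ fin (suc k) → δ ≡ c * d →
  (Odd u × ∃ λ W → Odd W × d ≡ (+ 2) ^ k * W) ⊎ (Even h × Even l × ∃ λ Y → d ≡ (+ 2) ^ suc k * Y) →
  ValuationAlternatives n u h l δ
valuation-alternatives {k = k} {c = c} {δ = δ} c-unit σn δ≡ (inj₁ (u-odd , W , W-odd , d≡)) =
  inj₁ (odd⇒σ≡0 u-odd , trans σn (cong suc∞ (sym (trans (cong σ δ≡2^k[cW]) σ[2^k[cW]]))))
  where
  δ≡2^k[cW] : δ ≡ (+ 2) ^ k * (c * W)
  δ≡2^k[cW] = trans δ≡ (trans (cong (c *_) d≡) (x∙yz≈y∙xz c ((+ 2) ^ k) W))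
  σ[2^k[cW]] = σ-2^*odd k (c * W) (odd-unit-* c-unit W-odd)
valuation-alternatives {k = k} {c = c} {δ = δ} c-unit σn δ≡ (inj₂ (h-even , l-even , Y , d≡)) =
  inj₂ (*∞-≢0 (even⇒σ≢0 h-even) (even⇒σ≢0 l-even) ,
        subst₂ _≤∞_ (sym σn) (cong σ (sym δ≡2^[1+k][cY])) (2^≤σ (suc k) (c * Y)))
  where
  δ≡2^[1+k][cY] : δ ≡ (+ 2) ^ suc k * (c * Y)
  δ≡2^[1+k][cY] = trans δ≡ (trans (cong (c *_) d≡) (x∙yz≈y∙xz c ((+ 2) ^ suc k) Y))

module Parts {c ℓ d : Level} (G : AbelianGroup c ℓ) (s s′ s₀ : AbelianGroup.Carrier G) where
  open AbelianGroup G using (Carrier; _≈_; ε)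
  open GroupDefs G
  open Coordinates G s s′ s₀

  module Hypotheses {D : Carrier → Set d} (code : IsPerfectCode S D) (s₀≉ε : ¬ s₀ ≈ ε)
    {a : ℤ} (a-unit : IsUnit a) (closed : ∀ i j k → D (x i j k) → D (x (i + a) (j + + 1) (k + + 1)))
    (hN lN : ℕ) (relation : Null (+ hN) (+ lN) (+ 0)) (order-s₀ : 2 ×ℕ s₀ ≈ ε) where

    open Translation code a closed

    h l : ℤ
    h = + hN
    l = + lN

    shift-onto-s₀-i : ∀ {m v r} n → n ≡ + v * l → s₀ ≈ (+ m) · s →
                      + v * (a * l - h + l * + m) ≡ + m * (+ 1 + + 2 * r) → x (n * a) n n ≈ s₀
    shift-onto-s₀-i {m} {v} {r} n refl s₀≈ ve≡ = x≈s₀-mod-null (n * a) n n (null-≡ first second third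
      (null-+ (null-+ (null-* (+ v) relation) (null-* μ (null-s₀≈·s s₀≈))) (null-* r (null-order-s₀ order-s₀))))
      where
      μ = + v * l - + 1 - + 2 * r
      identity₁ : ∀ v h l a m r →
        v * h + (v * l - + 1 - + 2 * r) * (- m) + r * + 0
          ≡ v * l * a - + 0 + (- + 1) * (v * (a * l - h + l * m) - m * (+ 1 + + 2 * r))
      identity₁ = solve-∀
      first : + v * h + μ * (- + m) + r * + 0 ≡ + v * l * a - + 0
      first = by-linear-combination ve≡ (- + 1) (identity₁ (+ v) h l a (+ m) r)
      identity₂ : ∀ v l r → v * l + (v * l - + 1 - + 2 * r) * + 0 + r * + 0 ≡ v * l - + 0
      identity₂ = solve-∀
      second : + v * l + μ * + 0 + r * + 0 ≡ + v * l - + 0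
      second = identity₂ (+ v) l r
      identity₃ : ∀ v l r → v * + 0 + (v * l - + 1 - + 2 * r) * + 1 + r * + 2 ≡ v * l - + 1
      identity₃ = solve-∀
      third : + v * + 0 + μ * + 1 + r * + 2 ≡ + v * l - + 1
      third = identity₃ (+ v) l r

    shift-onto-s₀-ii : ∀ {m v r} n → n ≡ + v * h → s₀ ≈ (+ m) · s′ →
                       + v * (h - a * l + h * + m) ≡ + m * (+ 1 + + 2 * r) → x (n * a) n n ≈ s₀
    shift-onto-s₀-ii {m} {v} {r} n refl s₀≈ ve≡ = x≈s₀-mod-null (n * a) n n (null-≡ first second third
      (null-+ (null-+ (null-* (+ v * a) relation) (null-* μ (null-s₀≈·s′ s₀≈))) (null-* r (null-order-s₀ order-s₀))))
      where
      μ = + v * h - + 1 - + 2 * r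
      identity₁ : ∀ v h a r → v * a * h + (v * h - + 1 - + 2 * r) * + 0 + r * + 0 ≡ v * h * a - + 0
      identity₁ = solve-∀
      first : + v * a * h + μ * + 0 + r * + 0 ≡ + v * h * a - + 0
      first = identity₁ (+ v) h a r
      identity₂ : ∀ v h l a m r →
        v * a * l + (v * h - + 1 - + 2 * r) * (- m) + r * + 0
          ≡ v * h - + 0 + (- + 1) * (v * (h - a * l + h * m) - m * (+ 1 + + 2 * r))
      identity₂ = solve-∀
      second : + v * a * l + μ * (- + m) + r * + 0 ≡ + v * h - + 0
      second = by-linear-combination ve≡ (- + 1) (identity₂ (+ v) h l a (+ m) r)
      identity₃ : ∀ v a h r → v * a * + 0 + (v * h - + 1 - + 2 * r) * + 1 + r * + 2 ≡ v * h - + 1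
      identity₃ = solve-∀
      third : + v * a * + 0 + μ * + 1 + r * + 2 ≡ + v * h - + 1
      third = identity₃ (+ v) a h r

    divisible-case-i : ∀ {n k q m E} → Odd q → + m ≡ (+ 2) ^ k * q → σ (+ n) ≡ fin (suc k) →
                       a * l - h + l * + m ≡ (+ 2) ^ suc k * E → ValuationAlternatives n l h l (l - a * h)
    divisible-case-i {k = k} {E = E} q-odd m≡ σn e≡ =
      valuation-alternatives a-unit σn δ≡ (Sum.map₂ with-h-even (factorise-divisible-sum {k} {a * l - h} {l} q-odd e≡′))
      where
      e≡′ = subst (λ M → a * l - h + l * M ≡ (+ 2) ^ suc k * E) m≡ e≡
      identity₁ : ∀ l a h → l - a * h ≡ a * (a * l - h) + (- l) * (a * a - + 1)
      identity₁ = solve-∀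
      δ≡ : l - a * h ≡ a * (a * l - h)
      δ≡ = by-linear-combination (unit-squared a-unit) (- l) (identity₁ l a h)
      identity₂ : ∀ a l h → a * l + - + 1 * (a * l - h) ≡ h
      identity₂ = solve-∀
      with-h-even : (Even l × ∃ λ Y → a * l - h ≡ (+ 2) ^ suc k * Y) →
                    Even h × Even l × ∃ λ Y → a * l - h ≡ (+ 2) ^ suc k * Y
      with-h-even (l-even , Y , d≡) =
        subst Even (identity₂ a l h) (even-combination l-even ((+ 2) ^ k * Y , trans d≡ (ℤₚ.*-assoc (+ 2) ((+ 2) ^ k) Y)) a (- + 1)) ,
        l-even , Y , d≡

    divisible-case-ii : ∀ {n k q m E} → Odd q → + m ≡ (+ 2) ^ k * q → σ (+ n) ≡ fin (suc k) →
                        h - a * l + h * + m ≡ (+ 2) ^ suc k * E → ValuationAlternatives n h h l (l - a * h)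
    divisible-case-ii {k = k} {E = E} q-odd m≡ σn e≡ =
      valuation-alternatives (unit-neg a-unit) σn δ≡ (Sum.map₂ with-l-even (factorise-divisible-sum {k} {h - a * l} {h} q-odd e≡′))
      where
      e≡′ = subst (λ M → h - a * l + h * M ≡ (+ 2) ^ suc k * E) m≡ e≡
      identity₁ : ∀ l a h → l - a * h ≡ - a * (h - a * l) + (- l) * (a * a - + 1)
      identity₁ = solve-∀
      δ≡ : l - a * h ≡ - a * (h - a * l)
      δ≡ = by-linear-combination (unit-squared a-unit) (- l) (identity₁ l a h)
      identity₂ : ∀ a l h → l ≡ a * h + - a * (h - a * l) + (- l) * (a * a - + 1)
      identity₂ = solve-∀
      with-l-even : (Even h × ∃ λ Y → h - a * l ≡ (+ 2) ^ suc k * Y) →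
                    Even h × Even l × ∃ λ Y → h - a * l ≡ (+ 2) ^ suc k * Y
      with-l-even (h-even , Y , d≡) =
        h-even ,
        subst Even (sym (by-linear-combination (unit-squared a-unit) (- l) (identity₂ a l h)))
              (even-combination h-even ((+ 2) ^ k * Y , trans d≡ (ℤₚ.*-assoc (+ 2) ((+ 2) ^ k) Y)) a (- a)) ,
        Y , d≡

    conclusion-i : ∀ os → 0 < os → 2 ∣ os → s₀ ≈ (+ (os / 2)) · s → ValuationAlternatives os l h l (l - a * h)
    conclusion-i os 0<os 2∣os s₀≈ with half-decomposition 2∣os 0<os
    ... | k , q , q-odd , m≡ , σos with divisible-or-odd-multiple k q (a * l - h + l * + (os / 2))
    ...   | inj₁ (E , e≡) = divisible-case-i q-odd m≡ σos e≡
    ...   | inj₂ (v , w , (r , refl) , ve≡) =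
      ⊥-elim (no-shift-onto-s₀ s₀≉ε (v ℕ.* lN)
        (shift-onto-s₀-i {os / 2} {v} {r} (+ (v ℕ.* lN)) (ℤₚ.pos-* v lN) s₀≈ (trans ve≡ (cong (_* (+ 1 + + 2 * r)) (sym m≡)))))

    conclusion-ii : ∀ os → 0 < os → 2 ∣ os → s₀ ≈ (+ (os / 2)) · s′ → ValuationAlternatives os h h l (l - a * h)
    conclusion-ii os 0<os 2∣os s₀≈ with half-decomposition 2∣os 0<os
    ... | k , q , q-odd , m≡ , σos with divisible-or-odd-multiple k q (h - a * l + h * + (os / 2))
    ...   | inj₁ (E , e≡) = divisible-case-ii q-odd m≡ σos e≡
    ...   | inj₂ (v , w , (r , refl) , ve≡) =
      ⊥-elim (no-shift-onto-s₀ s₀≉ε (v ℕ.* hN)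
        (shift-onto-s₀-ii {os / 2} {v} {r} (+ (v ℕ.* hN)) (ℤₚ.pos-* v hN) s₀≈ (trans ve≡ (cong (_* (+ 1 + + 2 * r)) (sym m≡)))))

lemma3p7 : ∀ {c ℓ d : Level} (G : AbelianGroup c ℓ) →
    let open AbelianGroup G
        open GroupDefs G
    in Finite →
    (s s′ s₀ : Carrier) →
    let S = s ∷ (s ⁻¹) ∷ s′ ∷ (s′ ⁻¹) ∷ s₀ ∷ []
        x : ℤ → ℤ → ℤ → Carrier
        x i j k = ((i · s) ∙ (j · s′)) ∙ (k · s₀)
    in Nonzero S → Distinct S → Generates S →
    (os os′ : ℕ) → IsOrder s os → IsOrder s′ os′ → IsOrder s₀ 2 →
    2 < os → 2 < os′ →
    (a : ℤ) → (a ≡ - + 1 ⊎ a ≡ + 1) →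
    (h l : ℤ) → (+ 0 ℤ.≤ h) → (h ℤ.≤ + os) → (+ 0 ℤ.≤ l) → (l ℤ.≤ + os′) →
    x (+ 0) (+ 0) (+ 0) ≈ x h l (+ 0) →
    (D : Carrier → Set d) → IsPerfectCode S D →
    (∀ i j k → D (x i j k) → D (x (i ℤ.+ a) (j ℤ.+ + 1) (k ℤ.+ + 1))) →
    ((2 ∣ os) → s₀ ≈ ((+ (os / 2)) · s) →
       ((σ l ≡ fin 0) × (σ (+ os) ≡ suc∞ (σ (l ℤ.- a ℤ.* h))))
       ⊎ ((σ h *∞ σ l ≢ fin 0) × (σ (+ os) ≤∞ σ (l ℤ.- a ℤ.* h))))
    ×
    ((2 ∣ os′) → s₀ ≈ ((+ (os′ / 2)) · s′) →
       ((σ h ≡ fin 0) × (σ (+ os′) ≡ suc∞ (σ (l ℤ.- a ℤ.* h))))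
       ⊎ ((σ h *∞ σ l ≢ fin 0) × (σ (+ os′) ≤∞ σ (l ℤ.- a ℤ.* h))))
lemma3p7 {d = d} G _ s s′ s₀ (_ ∷ _ ∷ _ ∷ _ ∷ s₀≉ε ∷ _) _ _ os os′ (0<os , _) (0<os′ , _) (_ , 2s₀≈ε , _) _ _
         a a-unit (+ hN) (+ lN) _ _ _ _ x₀≈xₕₗ D code closed =
  conclusion-i os 0<os , conclusion-ii os′ 0<os′
  where
  open AbelianGroup G using () renaming (sym to ≈-sym; trans to ≈-trans)
  open Coordinates G s s′ s₀ using (null; x-axis₁)
  open Parts {d = d} G s s′ s₀
  open Hypotheses code s₀≉ε a-unit closed hN lN (null (≈-trans (≈-sym x₀≈xₕₗ) (x-axis₁ (+ 0)))) 2s₀≈ε
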